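{- Let $\ell=(\vec v_1=e_1;\dots;\vec v_n=e_n\ \mathtt{in}\ \vec v_{n+1})$ be a well-typed let-term. Then $$\mathrm{Var}(\mathrm{Facts}(\ell))=FV(\ell)\uplus\big(FV^a(\vec v_{n+1})\setminus FV(\ell)\big)\uplus\Big(\biguplus_{i=1}^nFV^+(\vec v_i)\Big).$$
   Context: Types: positive $P,Q::=\mathsf{Bool}\mid P\otimes Q$; arrow $N::=P\multimap T$; let-term types $T,U::=P\mid N\mid P\otimes T$. Each variable carries a fixed type $\mathsf{ty}(v)$, positive or arrow; $x,y,z$ positive variables, $f,g,h$ arrow variables. Webs: $|\mathsf{Bool}|=\{\mathsf t,\mathsf f\}$, $|P\otimes T|=|P\multimap T|=|P|\times|T|$. Constants $M$: stochastic matrices of type $P\multimap Q$ (or $0$-ary of type $Q$). Syntax: patterns $\vec v::=v\mid(\vec v,\vec v')$ (components with disjoint variables); expressions $e::=v\mid M(\vec x)\mid f\,\vec x\mid (e,e')\mid \lambda\vec x.e\mid \mathtt{let}\ \vec v=e\ \mathtt{in}\ e'$ ($\vec x$ positive pattern); let-terms $\ell::=\vec v\mid \mathtt{let}\ \vec v=e\ \mathtt{in}\ \ell$; $(\vec v_1=e_1;\dots;\vec v_n=e_n\ \mathtt{in}\ \vec v_{n+1})$ abbreviates nested lets, $\vec v_{n+1}$ being the output. $FV$ denotes free variables; $FV^a$, $FV^+$ the arrow and positive ones (for a pattern, all its variables). Typing: $v:\mathsf{ty}(v)$; $f:P\multimap T,\vec x:P\Rightarrow f\vec x:T$; $M:P\multimap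 Q,\vec x:P\Rightarrow M(\vec x):Q$; $\vec x:P,e:T\Rightarrow\lambda\vec x.e:P\multimap T$; $e:P,e':T$, $FV^a(e)\cap FV^a(e')=\emptyset\Rightarrow(e,e'):P\otimes T$; $\vec v:T,e:T,e':U$, $FV^a(e)\cap FV^a(e')=\emptyset$, each arrow variable of $\vec v$ in $FV^a(e')$ $\Rightarrow\mathtt{let}\ \vec v=e\ \mathtt{in}\ e':U$. Bound variables pairwise distinct and distinct from free ones; $\vec v_1,\dots,\vec v_n$ pairwise disjoint. Semantics: $|V|=\prod_{v\in V}|\mathsf{ty}(v)|$; $[\![e]\!]\in\mathbb R_{\ge0}^{|FV(e)|\times|\mathsf{ty}(e)|}$ is the denotation of $e$ (only its index sets matter here). Factors: pairs $(\mathrm{Var}(\varphi),\varphi:|\mathrm{Var}(\varphi)|\to\mathbb R_{\ge0})$; $\mathrm{Var}(\sum_S\varphi)=\mathrm{Var}(\varphi)\setminus S$ with $(\sum_S\varphi)(a)=\sum_{b\in|S\cap\mathrm{Var}(\varphi)|}\varphi(a\uplus b)$; $\mathrm{Var}(\varphi\odot\psi)=\mathrm{Var}(\varphi)\cup\mathrm{Var}(\psi)$ with $(\varphi\odot\psi)(c)=\varphi(c|_{\mathrm{Var}(\varphi)})\psi(c|_{\mathrm{Var}(\psi)})$. For finite $\Gamma$: $\mathrm{Var}(\Gamma)=\bigcup_{\varphi\in\Gamma}\mathrm{Var}(\varphi)$, $\bigodot\Gamma$ product, $\Gamma_V=\{\varphi\in\Gamma:\mathrm{Var}(\varphi)\cap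 V\ne\emptyset\}$, $\Gamma_{\neg V}=\Gamma\setminus\Gamma_V$. $\mathrm{Fact}(\vec v=e)$: variables $FV(e)\uplus FV(\vec v)$, function $a\uplus c\mapsto[\![e]\!]_{a,c}$. $\mathrm{Facts}(\vec w)=\{(FV(\vec w),a\mapsto1)\}$; for $\ell$ with output $\vec w$, $\mathrm{Facts}(\mathtt{let}\ \vec v=e\ \mathtt{in}\ \ell)=\{\sum_{\{f\}}(\mathrm{Fact}(\vec v=e)\odot\bigodot\mathrm{Facts}(\ell)_f)\}\uplus\mathrm{Facts}(\ell)_{\neg f}$ if $\vec v$ contains an arrow variable $f\notin FV(\vec w)$, and $\{\mathrm{Fact}(\vec v=e)\}\uplus\mathrm{Facts}(\ell)$ otherwise. -}

module Defs where

open import Data.Nat using (ℕ; _≟_)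
open import Data.Bool using (Bool; true; false; not)
open import Data.Maybe using (Maybe; just; nothing)
open import Data.List using (List; []; _∷_; _++_; concat; map; filter; filterᵇ)
open import Data.Product using (_×_; ∃-syntax)
open import Relation.Nullary using (¬?)
open import Relation.Binary.PropositionalEquality using (_≡_)
open import Data.List.Membership.DecPropositional _≟_ using (_∈?_)
open import Data.List.Relation.Binary.Disjoint.Propositional using (Disjoint)
open import Data.List.Relation.Binary.Subset.Propositional using (_⊆_)
open import Data.List.Relation.Unary.AllPairs using (AllPairs)

data PTy : Set where
  𝔹   : PTy
  _⊗_ : PTy → PTy → PTy

-- let-term types T ::= P | N | P ⊗ T, with arrows N ::= P ⊸ T.
-- Canonical representation: a let-term type is either positive, or a
-- "non-positive" type NP ::= N | P ⊗ NP  (so P ⊗ Q is only ever `pos (P ⊗ Q)`).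
mutual
  data TTy : Set where
    pos : PTy → TTy
    np  : NPTy → TTy

  data NPTy : Set where
    arr  : PTy → TTy → NPTy
    tens : PTy → NPTy → NPTy

_⊗ᵀ_ : PTy → TTy → TTy
P ⊗ᵀ pos Q = pos (P ⊗ Q)
P ⊗ᵀ np N  = np (tens P N)

data VTy : Set where
  vpos : PTy → VTy
  varr : PTy → TTy → VTy

⟦_⟧v : VTy → TTy
⟦ vpos P ⟧v   = pos P
⟦ varr P T ⟧v = np (arr P T)

isArrow : VTy → Bool
isArrow (vpos _)   = false
isArrow (varr _ _) = true

data Pattern : Set where
  pvar  : ℕ → Pattern
  ppair : Pattern → Pattern → Pattern

-- A constant M is recorded through its type only (its matrix entries are
-- irrelevant to the index sets / variable sets studied here).
data Expr : Set where
  var  : ℕ → Expr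
  mat  : PTy → PTy → Pattern → Expr
  cst  : PTy → Expr
  app  : ℕ → Pattern → Expr
  pair : Expr → Expr → Expr
  lam  : Pattern → Expr → Expr
  elet : Pattern → Expr → Expr → Expr

data LetTerm : Set where
  ret  : Pattern → LetTerm
  llet : Pattern → Expr → LetTerm → LetTerm

vars : Pattern → List ℕ
vars (pvar v)    = v ∷ []
vars (ppair p q) = vars p ++ vars q

_∖_ : List ℕ → List ℕ → List ℕ
xs ∖ ys = filter (λ v → ¬? (v ∈? ys)) xs

FV : Expr → List ℕ
FV (var v)      = v ∷ []
FV (mat _ _ x)  = vars x
FV (cst _)      = []
FV (app f x)    = f ∷ vars x
FV (pair e e')  = FV e ++ FV e'
FV (lam x e)    = FV e ∖ vars x
FV (elet v e e') = FV e ++ (FV e' ∖ vars v)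

FVℓ : LetTerm → List ℕ
FVℓ (ret w)      = vars w
FVℓ (llet v e ℓ) = FV e ++ (FVℓ ℓ ∖ vars v)

BV : Expr → List ℕ
BV (var _)       = []
BV (mat _ _ _)   = []
BV (cst _)       = []
BV (app _ _)     = []
BV (pair e e')   = BV e ++ BV e'
BV (lam x e)     = vars x ++ BV e
BV (elet v e e') = vars v ++ BV e ++ BV e'

BVℓ : LetTerm → List ℕ
BVℓ (ret _)      = []
BVℓ (llet v e ℓ) = vars v ++ BV e ++ BVℓ ℓ

output : LetTerm → Pattern
output (ret w)      = w
output (llet _ _ ℓ) = output ℓ

binders : LetTerm → List Pattern
binders (ret _)      = []
binders (llet v _ ℓ) = v ∷ binders ℓ

module WithTy (ty : ℕ → VTy) where

  -- arrow / positive variables among a list  (FVᵃ, FV⁺)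
  arrows : List ℕ → List ℕ
  arrows = filterᵇ (λ v → isArrow (ty v))

  positives : List ℕ → List ℕ
  positives = filterᵇ (λ v → not (isArrow (ty v)))

  FVᵃ : Expr → List ℕ
  FVᵃ e = arrows (FV e)

  FVᵃℓ : LetTerm → List ℕ
  FVᵃℓ ℓ = arrows (FVℓ ℓ)

  data _∶ᵖ_ : Pattern → TTy → Set where
    tp-var  : ∀ {v} → pvar v ∶ᵖ ⟦ ty v ⟧v
    tp-pair : ∀ {p q P T} → p ∶ᵖ pos P → q ∶ᵖ T →
              Disjoint (vars p) (vars q) → ppair p q ∶ᵖ (P ⊗ᵀ T)

  data _∶_ : Expr → TTy → Set where
    t-var  : ∀ {v} → var v ∶ ⟦ ty v ⟧v
    t-mat  : ∀ {P Q x} → x ∶ᵖ pos P → mat P Q x ∶ pos Q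
    t-cst  : ∀ {Q} → cst Q ∶ pos Q
    t-app  : ∀ {f P T x} → ty f ≡ varr P T → x ∶ᵖ pos P → app f x ∶ T
    t-lam  : ∀ {x e P T} → x ∶ᵖ pos P → e ∶ T → lam x e ∶ np (arr P T)
    t-pair : ∀ {e e' P T} → e ∶ pos P → e' ∶ T →
             Disjoint (FVᵃ e) (FVᵃ e') → pair e e' ∶ (P ⊗ᵀ T)
    t-let  : ∀ {v e e' T U} → v ∶ᵖ T → e ∶ T → e' ∶ U →
             Disjoint (FVᵃ e) (FVᵃ e') →
             arrows (vars v) ⊆ FVᵃ e' →
             elet v e e' ∶ U

  data _∶ℓ_ : LetTerm → TTy → Set where
    tℓ-ret : ∀ {w T} → w ∶ᵖ T → ret w ∶ℓ T
    tℓ-let : ∀ {v e ℓ T U} → v ∶ᵖ T → e ∶ T → ℓ ∶ℓ U →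
             Disjoint (FVᵃ e) (FVᵃℓ ℓ) →
             arrows (vars v) ⊆ FVᵃℓ ℓ →
             llet v e ℓ ∶ℓ U

  -- Factors, represented by their variable set Var(φ) (a list).
  -- Var(Σ_S φ) = Var(φ) ∖ S,  Var(φ ⊙ ψ) = Var(φ) ∪ Var(ψ).

  Scope : Set
  Scope = List ℕ

  VarΓ : List Scope → List ℕ
  VarΓ = concat

  Fact : Pattern → Expr → Scope
  Fact v e = FV e ++ vars v

  _with-var_ : List Scope → ℕ → List Scope
  Γ with-var f = filter (λ φ → f ∈? φ) Γ

  _without-var_ : List Scope → ℕ → List Scope
  Γ without-var f = filter (λ φ → ¬? (f ∈? φ)) Γ

  -- an arrow variable of v⃗ not in FV(w⃗), if any
  -- (for well-typed patterns there is at most one arrow variable)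
  firstOf : List ℕ → Maybe ℕ
  firstOf []      = nothing
  firstOf (x ∷ _) = just x

  Facts : LetTerm → List Scope
  Facts (ret w) = vars w ∷ []
  Facts (llet v e ℓ) with firstOf (arrows (vars v) ∖ vars (output ℓ))
  ... | just f  = ((VarΓ (Fact v e ∷ (Facts ℓ with-var f))) ∖ (f ∷ []))
                  ∷ (Facts ℓ without-var f)
  ... | nothing = Fact v e ∷ Facts ℓ

_≋_ : List ℕ → List ℕ → Set
A ≋ B = (A ⊆ B) × (B ⊆ A)

PairwiseDisjoint : List (List ℕ) → Set
PairwiseDisjoint = AllPairs Disjoint

{-# OPTIONS --safe #-}
-- A binding v⃗ = e contributes the scope FV(e) ⊎ FV(v⃗).
-- Its positive variables are never summed out. Its arrow variable (a well-typed pattern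
-- binds at most one) either occurs in the output, or it is the variable f that Facts sums
-- out; summing out f deletes f and nothing else, since the factors not mentioning f are
-- kept. Finally f is not in the claimed set: hygiene makes it non-free, the output does
-- not mention it, and the later binders contribute only positive variables.
module Submission where

open import Defs
open import Data.Nat using (ℕ; _≟_)
open import Data.Bool using (T; true; false; not)
open import Data.Bool.Properties using (T?)
open import Data.Empty using (⊥; ⊥-elim)
open import Data.List using (List; []; _∷_; _++_; map; concat)
open import Data.Maybe using (just; nothing)
open import Data.Product using (_×_; _,_; proj₁; proj₂; ∃-syntax)
open import Data.Sum using (_⊎_; inj₁; inj₂; [_,_])
open import Function using (id; _∘_)
open import Relation.Nullary using (yes; no; ¬?)
open import Relation.Binary.PropositionalEquality using (_≡_; refl)
open import Data.List.Membership.Propositional using (_∈_; _∉_)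
open import Data.List.Membership.Propositional.Properties
  using (∈-++⁺ˡ; ∈-++⁺ʳ; ∈-++⁻; ∈-concat⁺′; ∈-concat⁻′; ∈-filter⁺; ∈-filter⁻)
open import Data.List.Membership.DecPropositional _≟_ using (_∈?_)
open import Data.List.Relation.Unary.Any using (here; there)
open import Data.List.Relation.Unary.All as All using (_∷_)
import Data.List.Relation.Unary.All.Properties as All
open import Data.List.Relation.Unary.AllPairs as AllPairs using (_∷_)
import Data.List.Relation.Unary.AllPairs.Properties as AllPairs
open import Data.List.Relation.Unary.Unique.Propositional using (Unique)
open import Data.List.Relation.Binary.Disjoint.Propositional using (Disjoint)
open import Data.List.Relation.Binary.Subset.Propositional using (_⊆_)
open import Data.List.Relation.Binary.Subset.Propositional.Properties
  using (⊆-trans; xs⊆xs++ys; xs⊆ys++xs; ++⁺ˡ; ++⁺ʳ; concat⁺; filter-⊆)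

∈-∖⁺ : ∀ {x xs ys} → x ∈ xs → x ∉ ys → x ∈ xs ∖ ys
∈-∖⁺ {ys = ys} = ∈-filter⁺ (λ v → ¬? (v ∈? ys))

∈-∖⁻ : ∀ {x} xs ys → x ∈ xs ∖ ys → x ∈ xs × x ∉ ys
∈-∖⁻ xs ys = ∈-filter⁻ (λ v → ¬? (v ∈? ys)) {xs = xs}

∖-⊆ : ∀ xs ys → xs ∖ ys ⊆ xs
∖-⊆ xs ys = filter-⊆ (λ v → ¬? (v ∈? ys)) xs

++-∖-≋ : ∀ xs ys zs → (xs ++ ys ++ zs) ≋ (xs ++ (ys ∖ xs) ++ zs)
++-∖-≋ xs ys zs = to , ++⁺ʳ xs (++⁺ˡ zs (∖-⊆ ys xs))
  where
  to : xs ++ ys ++ zs ⊆ xs ++ (ys ∖ xs) ++ zs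
  to m with ∈-++⁻ xs m
  ... | inj₁ x∈xs = ∈-++⁺ˡ x∈xs
  ... | inj₂ m′ with ∈-++⁻ ys m′
  ...   | inj₂ x∈zs = ∈-++⁺ʳ xs (∈-++⁺ʳ (ys ∖ xs) x∈zs)
  ...   | inj₁ x∈ys with _ ∈? xs
  ...     | yes x∈xs = ∈-++⁺ˡ x∈xs
  ...     | no x∉xs = ∈-++⁺ʳ xs (∈-++⁺ˡ (∈-∖⁺ x∈ys x∉xs))

Disjoint-⊆ : ∀ {xs xs′ ys ys′ : List ℕ} →
             xs ⊆ xs′ → ys ⊆ ys′ → Disjoint xs′ ys′ → Disjoint xs ys
Disjoint-⊆ xs⊆ ys⊆ disj (x∈xs , x∈ys) = disj (xs⊆ x∈xs , ys⊆ x∈ys)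

Unique-++⁻ʳ : ∀ xs {ys : List ℕ} → Unique (xs ++ ys) → Unique ys
Unique-++⁻ʳ []       u       = u
Unique-++⁻ʳ (_ ∷ xs) (_ ∷ u) = Unique-++⁻ʳ xs u

Unique-++⇒Disjoint : ∀ xs {ys : List ℕ} → Unique (xs ++ ys) → Disjoint xs ys
Unique-++⇒Disjoint (_ ∷ xs) (x∉ ∷ _) (here refl , x∈ys) = All.lookup x∉ (∈-++⁺ʳ xs x∈ys) refl
Unique-++⇒Disjoint (_ ∷ xs) (_ ∷ u)  (there x∈xs , x∈ys) = Unique-++⇒Disjoint xs u (x∈xs , x∈ys)

T-not⇒¬T : ∀ {b} → T (not b) → T b → ⊥
T-not⇒¬T {true} ()

Disjoint-BVℓ-FVℓ-tail : ∀ v e ℓ → Unique (BVℓ (llet v e ℓ)) →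
                        Disjoint (BVℓ (llet v e ℓ)) (FVℓ (llet v e ℓ)) →
                        Disjoint (BVℓ ℓ) (FVℓ ℓ)
Disjoint-BVℓ-FVℓ-tail v e ℓ u disj (x∈BV , x∈FV) with _ ∈? vars v
... | yes x∈v = Unique-++⇒Disjoint (vars v) u (x∈v , ∈-++⁺ʳ (BV e) x∈BV)
... | no x∉v  = disj ( ∈-++⁺ʳ (vars v) (∈-++⁺ʳ (BV e) x∈BV)
                     , ∈-++⁺ʳ (FV e) (∈-∖⁺ x∈FV x∉v))

Unique-BVℓ-tail : ∀ v e ℓ → Unique (BVℓ (llet v e ℓ)) → Unique (BVℓ ℓ)
Unique-BVℓ-tail v e ℓ u = Unique-++⁻ʳ (BV e) (Unique-++⁻ʳ (vars v) u)

binder⊆BVℓ : ∀ ℓ {p} → p ∈ binders ℓ → vars p ⊆ BVℓ ℓ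
binder⊆BVℓ (llet v e ℓ) (here refl) = xs⊆xs++ys (vars v) _
binder⊆BVℓ (llet v e ℓ) (there p∈) =
  ⊆-trans (binder⊆BVℓ ℓ p∈) (⊆-trans (xs⊆ys++xs _ (BV e)) (xs⊆ys++xs _ (vars v)))

module _ (ty : ℕ → VTy) where
  open WithTy ty

  Arrow Positive : ℕ → Set
  Arrow x    = T (isArrow (ty x))
  Positive x = T (not (isArrow (ty x)))

  arrow-or-positive : ∀ x → Arrow x ⊎ Positive x
  arrow-or-positive x with isArrow (ty x)
  ... | true  = inj₁ _
  ... | false = inj₂ _

  arrow⇒¬positive : ∀ {x} → Arrow x → Positive x → ⊥
  arrow⇒¬positive a p = T-not⇒¬T p a

  ∈-arrows⁺ : ∀ {x xs} → x ∈ xs → Arrow x → x ∈ arrows xs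
  ∈-arrows⁺ = ∈-filter⁺ (λ v → T? (isArrow (ty v)))

  ∈-arrows⁻ : ∀ {x} xs → x ∈ arrows xs → x ∈ xs × Arrow x
  ∈-arrows⁻ xs = ∈-filter⁻ (λ v → T? (isArrow (ty v))) {xs = xs}

  ∈-positives⁺ : ∀ {x xs} → x ∈ xs → Positive x → x ∈ positives xs
  ∈-positives⁺ = ∈-filter⁺ (λ v → T? (not (isArrow (ty v))))

  ∈-positives⁻ : ∀ {x} xs → x ∈ positives xs → x ∈ xs × Positive x
  ∈-positives⁻ xs = ∈-filter⁻ (λ v → T? (not (isArrow (ty v)))) {xs = xs}

  pattern-arrow⇒np : ∀ {p T x} → p ∶ᵖ T → x ∈ vars p → Arrow x → ∃[ N ] T ≡ np N
  pattern-arrow⇒np (tp-var {v}) (here refl) a with ty v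
  ... | varr P T = arr P T , refl
  ... | vpos _   = ⊥-elim a
  pattern-arrow⇒np (tp-pair {p} tp tq _) x∈ a with ∈-++⁻ (vars p) x∈
  ... | inj₁ x∈p with pattern-arrow⇒np tp x∈p a
  ...   | _ , ()
  pattern-arrow⇒np (tp-pair {P = P} tp tq _) x∈ a | inj₂ x∈q with pattern-arrow⇒np tq x∈q a
  ...   | N , refl = tens P N , refl

  positive-pattern : ∀ {p P x} → p ∶ᵖ pos P → x ∈ vars p → Positive x
  positive-pattern tp x∈ with arrow-or-positive _
  ... | inj₂ positive = positive
  ... | inj₁ arrow with pattern-arrow⇒np tp x∈ arrow
  ...   | _ , ()

  pattern-arrow-unique : ∀ {p T x y} → p ∶ᵖ T → x ∈ vars p → y ∈ vars p →
                         Arrow x → Arrow y → x ≡ y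
  pattern-arrow-unique tp-var (here refl) (here refl) _ _ = refl
  pattern-arrow-unique (tp-pair {p} tp tq _) x∈ y∈ ax ay
    with ∈-++⁻ (vars p) x∈ | ∈-++⁻ (vars p) y∈
  ... | inj₁ x∈p | _        = ⊥-elim (arrow⇒¬positive ax (positive-pattern tp x∈p))
  ... | inj₂ _   | inj₁ y∈p = ⊥-elim (arrow⇒¬positive ay (positive-pattern tp y∈p))
  ... | inj₂ x∈q | inj₂ y∈q = pattern-arrow-unique tq x∈q y∈q ax ay

  firstOf-just : ∀ {xs f} → firstOf xs ≡ just f → f ∈ xs
  firstOf-just {_ ∷ _} refl = here refl

  firstOf-nothing : ∀ {xs x} → firstOf xs ≡ nothing → x ∉ xs
  firstOf-nothing {[]} refl ()

  sumOut : ℕ → Scope → List Scope → List Scope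
  sumOut f φ Γ = (VarΓ (φ ∷ (Γ with-var f)) ∖ (f ∷ [])) ∷ (Γ without-var f)

  ∉-VarΓ-without-var : ∀ Γ f → f ∉ VarΓ (Γ without-var f)
  ∉-VarΓ-without-var Γ f f∈ with ∈-concat⁻′ (Γ without-var f) f∈
  ... | φ , f∈φ , φ∈ = proj₂ (∈-filter⁻ (λ φ → ¬? (f ∈? φ)) {xs = Γ} φ∈) f∈φ

  VarΓ-with-var-⊆ : ∀ Γ f → VarΓ (Γ with-var f) ⊆ VarΓ Γ
  VarΓ-with-var-⊆ Γ f = concat⁺ (filter-⊆ (f ∈?_) Γ)

  VarΓ-without-var-⊆ : ∀ Γ f → VarΓ (Γ without-var f) ⊆ VarΓ Γ
  VarΓ-without-var-⊆ Γ f = concat⁺ (filter-⊆ (λ φ → ¬? (f ∈? φ)) Γ)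

  VarΓ-split : ∀ Γ f {x} → x ∈ VarΓ Γ →
               x ∈ VarΓ (Γ with-var f) ⊎ x ∈ VarΓ (Γ without-var f)
  VarΓ-split Γ f x∈ with ∈-concat⁻′ Γ x∈
  ... | φ , x∈φ , φ∈ with f ∈? φ
  ...   | yes f∈φ = inj₁ (∈-concat⁺′ x∈φ (∈-filter⁺ (f ∈?_) φ∈ f∈φ))
  ...   | no f∉φ  = inj₂ (∈-concat⁺′ x∈φ (∈-filter⁺ (λ φ → ¬? (f ∈? φ)) φ∈ f∉φ))

  VarΓ-sumOut : ∀ f φ Γ → VarΓ (sumOut f φ Γ) ≋ ((φ ++ VarΓ Γ) ∖ (f ∷ []))
  VarΓ-sumOut f φ Γ = to , from
    where
    to : VarΓ (sumOut f φ Γ) ⊆ (φ ++ VarΓ Γ) ∖ (f ∷ [])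
    to x∈ with ∈-++⁻ (VarΓ (φ ∷ (Γ with-var f)) ∖ (f ∷ [])) x∈
    ... | inj₁ x∈head with ∈-∖⁻ _ (f ∷ []) x∈head
    ...   | x∈ , x≢f = ∈-∖⁺ (++⁺ʳ φ (VarΓ-with-var-⊆ Γ f) x∈) x≢f
    to x∈ | inj₂ x∈tail = ∈-∖⁺ (∈-++⁺ʳ φ (VarΓ-without-var-⊆ Γ f x∈tail))
                               λ { (here refl) → ∉-VarΓ-without-var Γ f x∈tail }
    from : (φ ++ VarΓ Γ) ∖ (f ∷ []) ⊆ VarΓ (sumOut f φ Γ)
    from x∈ with ∈-∖⁻ (φ ++ VarΓ Γ) (f ∷ []) x∈
    ... | x∈′ , x≢f with ∈-++⁻ φ x∈′
    ...   | inj₁ x∈φ = ∈-++⁺ˡ (∈-∖⁺ (∈-++⁺ˡ x∈φ) x≢f)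
    ...   | inj₂ x∈Γ with VarΓ-split Γ f x∈Γ
    ...     | inj₁ x∈with = ∈-++⁺ˡ (∈-∖⁺ (∈-++⁺ʳ φ x∈with) x≢f)
    ...     | inj₂ x∈without = ∈-++⁺ʳ _ x∈without

  boundPositives : LetTerm → List ℕ
  boundPositives ℓ = concat (map (λ p → positives (vars p)) (binders ℓ))

  factVars : LetTerm → List ℕ
  factVars ℓ = FVℓ ℓ ++ arrows (vars (output ℓ)) ++ boundPositives ℓ

  danglingArrows : Pattern → LetTerm → List ℕ
  danglingArrows v ℓ = arrows (vars v) ∖ vars (output ℓ)

  boundPositives-positive : ∀ ℓ {x} → x ∈ boundPositives ℓ → Positive x
  boundPositives-positive (llet v e ℓ) x∈ with ∈-++⁻ (positives (vars v)) x∈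
  ... | inj₁ x∈v = proj₂ (∈-positives⁻ (vars v) x∈v)
  ... | inj₂ x∈ℓ = boundPositives-positive ℓ x∈ℓ

  dangling-unique : ∀ {v T} ℓ {x y} → v ∶ᵖ T → x ∈ danglingArrows v ℓ →
                    y ∈ danglingArrows v ℓ → x ≡ y
  dangling-unique {v} ℓ tv x∈ y∈
    with ∈-arrows⁻ (vars v) (proj₁ (∈-∖⁻ _ (vars (output ℓ)) x∈))
       | ∈-arrows⁻ (vars v) (proj₁ (∈-∖⁻ _ (vars (output ℓ)) y∈))
  ... | x∈v , ax | y∈v , ay = pattern-arrow-unique tv x∈v y∈v ax ay

  binder-var-kept-or-dangling : ∀ v e ℓ {x} → x ∈ vars v →
                                x ∈ factVars (llet v e ℓ) ⊎ x ∈ danglingArrows v ℓ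
  binder-var-kept-or-dangling v e ℓ {x} x∈v with arrow-or-positive x
  ... | inj₂ px = inj₁ (∈-++⁺ʳ (FVℓ (llet v e ℓ)) (∈-++⁺ʳ (arrows (vars (output ℓ)))
                          (∈-++⁺ˡ (∈-positives⁺ x∈v px))))
  ... | inj₁ ax with x ∈? vars (output ℓ)
  ...   | yes x∈out = inj₁ (∈-++⁺ʳ (FVℓ (llet v e ℓ)) (∈-++⁺ˡ (∈-arrows⁺ x∈out ax)))
  ...   | no x∉out  = inj₂ (∈-∖⁺ (∈-arrows⁺ x∈v ax) x∉out)

  factVars-llet-⊆ : ∀ v e ℓ {x} → x ∈ Fact v e ++ factVars ℓ →
                    x ∈ factVars (llet v e ℓ) ⊎ x ∈ danglingArrows v ℓ
  factVars-llet-⊆ v e ℓ {x} x∈ with ∈-++⁻ (FV e ++ vars v) x∈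
  ... | inj₁ x∈fact with ∈-++⁻ (FV e) x∈fact
  ...   | inj₁ x∈e = inj₁ (∈-++⁺ˡ (∈-++⁺ˡ x∈e))
  ...   | inj₂ x∈v = binder-var-kept-or-dangling v e ℓ x∈v
  factVars-llet-⊆ v e ℓ {x} x∈ | inj₂ x∈ℓ with ∈-++⁻ (FVℓ ℓ) x∈ℓ
  ... | inj₁ x∈FV with x ∈? vars v
  ...   | yes x∈v = binder-var-kept-or-dangling v e ℓ x∈v
  ...   | no x∉v  = inj₁ (∈-++⁺ˡ (∈-++⁺ʳ (FV e) (∈-∖⁺ x∈FV x∉v)))
  factVars-llet-⊆ v e ℓ {x} x∈ | inj₂ x∈ℓ | inj₂ x∈rest = inj₁ (∈-++⁺ʳ (FVℓ (llet v e ℓ))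
    (++⁺ʳ (arrows (vars (output ℓ))) (xs⊆ys++xs _ (positives (vars v))) x∈rest))

  factVars-llet-⊇ : ∀ v e ℓ → factVars (llet v e ℓ) ⊆ Fact v e ++ factVars ℓ
  factVars-llet-⊇ v e ℓ x∈ with ∈-++⁻ (FVℓ (llet v e ℓ)) x∈
  ... | inj₁ x∈FV with ∈-++⁻ (FV e) x∈FV
  ...   | inj₁ x∈e = ∈-++⁺ˡ (∈-++⁺ˡ x∈e)
  ...   | inj₂ x∈FVℓ = ∈-++⁺ʳ (Fact v e) (∈-++⁺ˡ (proj₁ (∈-∖⁻ (FVℓ ℓ) (vars v) x∈FVℓ)))
  factVars-llet-⊇ v e ℓ x∈ | inj₂ x∈rest with ∈-++⁻ (arrows (vars (output ℓ))) x∈rest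
  ... | inj₁ x∈out = ∈-++⁺ʳ (Fact v e) (∈-++⁺ʳ (FVℓ ℓ) (∈-++⁺ˡ x∈out))
  ... | inj₂ x∈bound with ∈-++⁻ (positives (vars v)) x∈bound
  ...   | inj₁ x∈v = ∈-++⁺ˡ (∈-++⁺ʳ (FV e) (proj₁ (∈-positives⁻ (vars v) x∈v)))
  ...   | inj₂ x∈ℓ = ∈-++⁺ʳ (Fact v e) (∈-++⁺ʳ (FVℓ ℓ) (∈-++⁺ʳ _ x∈ℓ))

  dangling∉factVars : ∀ v e ℓ {f} → Disjoint (BVℓ (llet v e ℓ)) (FVℓ (llet v e ℓ)) →
                      f ∈ danglingArrows v ℓ → f ∉ factVars (llet v e ℓ)
  dangling∉factVars v e ℓ disj f∈ f∈′ with ∈-∖⁻ (arrows (vars v)) (vars (output ℓ)) f∈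
  ... | f∈arrows , f∉out with ∈-arrows⁻ (vars v) f∈arrows
  ...   | f∈v , af with ∈-++⁻ (FVℓ (llet v e ℓ)) f∈′
  ...     | inj₁ f∈FV = disj (∈-++⁺ˡ f∈v , f∈FV)
  ...     | inj₂ f∈rest with ∈-++⁻ (arrows (vars (output ℓ))) f∈rest
  ...       | inj₁ f∈out   = f∉out (proj₁ (∈-arrows⁻ _ f∈out))
  ...       | inj₂ f∈bound = arrow⇒¬positive af (boundPositives-positive (llet v e ℓ) f∈bound)

  VarΓ-Facts-llet-⊆ : ∀ {v e ℓ T} → v ∶ᵖ T → VarΓ (Facts ℓ) ⊆ factVars ℓ →
                      VarΓ (Facts (llet v e ℓ)) ⊆ factVars (llet v e ℓ)
  VarΓ-Facts-llet-⊆ {v} {e} {ℓ} tv IH with firstOf (danglingArrows v ℓ) in eq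
  ... | nothing = [ id , (λ x∈ → ⊥-elim (firstOf-nothing eq x∈)) ]
                ∘ factVars-llet-⊆ v e ℓ ∘ ++⁺ʳ (Fact v e) IH
  ... | just f = kept ∘ ∈-∖⁻ _ (f ∷ []) ∘ proj₁ (VarΓ-sumOut f (Fact v e) (Facts ℓ))
    where
    kept : ∀ {x} → x ∈ Fact v e ++ VarΓ (Facts ℓ) × x ∉ f ∷ [] → x ∈ factVars (llet v e ℓ)
    kept (x∈ , x≢f) with factVars-llet-⊆ v e ℓ (++⁺ʳ (Fact v e) IH x∈)
    ... | inj₁ x∈′ = x∈′
    ... | inj₂ x∈dangling = ⊥-elim (x≢f (here (dangling-unique ℓ tv x∈dangling (firstOf-just eq))))

  VarΓ-Facts-⊆ : ∀ {ℓ U} → ℓ ∶ℓ U → VarΓ (Facts ℓ) ⊆ factVars ℓ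
  VarΓ-Facts-⊆ {ret w} _             = ++⁺ʳ (vars w) (λ ())
  VarΓ-Facts-⊆ (tℓ-let tv _ tℓ _ _) = VarΓ-Facts-llet-⊆ tv (VarΓ-Facts-⊆ tℓ)

  factVars-llet-⊆-VarΓ-Facts : ∀ v e ℓ → Disjoint (BVℓ (llet v e ℓ)) (FVℓ (llet v e ℓ)) →
                               factVars ℓ ⊆ VarΓ (Facts ℓ) →
                               factVars (llet v e ℓ) ⊆ VarΓ (Facts (llet v e ℓ))
  factVars-llet-⊆-VarΓ-Facts v e ℓ disj IH with firstOf (danglingArrows v ℓ) in eq
  ... | nothing = ++⁺ʳ (Fact v e) IH ∘ factVars-llet-⊇ v e ℓ
  ... | just f = λ x∈ → proj₂ (VarΓ-sumOut f (Fact v e) (Facts ℓ))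
                  (∈-∖⁺ (++⁺ʳ (Fact v e) IH (factVars-llet-⊇ v e ℓ x∈))
                        λ { (here refl) → dangling∉factVars v e ℓ disj (firstOf-just eq) x∈ })

  factVars-⊆-VarΓ-Facts : ∀ ℓ → Unique (BVℓ ℓ) → Disjoint (BVℓ ℓ) (FVℓ ℓ) →
                          factVars ℓ ⊆ VarΓ (Facts ℓ)
  factVars-⊆-VarΓ-Facts (ret w) _ _ x∈ with ∈-++⁻ (vars w) x∈
  ... | inj₁ x∈w = ∈-++⁺ˡ x∈w
  ... | inj₂ x∈arrows with ∈-++⁻ (arrows (vars w)) x∈arrows
  ...   | inj₁ x∈a = ∈-++⁺ˡ (proj₁ (∈-arrows⁻ (vars w) x∈a))
  ...   | inj₂ ()
  factVars-⊆-VarΓ-Facts (llet v e ℓ) u disj =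
    factVars-llet-⊆-VarΓ-Facts v e ℓ disj
      (factVars-⊆-VarΓ-Facts ℓ (Unique-BVℓ-tail v e ℓ u) (Disjoint-BVℓ-FVℓ-tail v e ℓ u disj))

  varBlocks : LetTerm → List (List ℕ)
  varBlocks ℓ = FVℓ ℓ ∷ (arrows (vars (output ℓ)) ∖ FVℓ ℓ) ∷ map (λ p → positives (vars p)) (binders ℓ)

  factVars-≋-varBlocks : ∀ ℓ → factVars ℓ ≋ concat (varBlocks ℓ)
  factVars-≋-varBlocks ℓ = ++-∖-≋ (FVℓ ℓ) (arrows (vars (output ℓ))) (boundPositives ℓ)

  varBlocks-disjoint : ∀ ℓ → Disjoint (BVℓ ℓ) (FVℓ ℓ) → PairwiseDisjoint (map vars (binders ℓ)) →
                       PairwiseDisjoint (varBlocks ℓ)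
  varBlocks-disjoint ℓ disj pd =
    (FV-outArrows ∷ All.map⁺ (All.tabulate FV-binder)) ∷
    All.map⁺ (All.tabulate outArrows-binder) ∷
    AllPairs.map⁺ (AllPairs.map (Disjoint-⊆ (positives-⊆ _) (positives-⊆ _)) (AllPairs.map⁻ pd))
    where
    out : List ℕ
    out = vars (output ℓ)
    positives-⊆ : ∀ xs → positives xs ⊆ xs
    positives-⊆ = filter-⊆ (λ v → T? (not (isArrow (ty v))))
    FV-outArrows : Disjoint (FVℓ ℓ) (arrows out ∖ FVℓ ℓ)
    FV-outArrows (x∈FV , x∈A) = proj₂ (∈-∖⁻ (arrows out) (FVℓ ℓ) x∈A) x∈FV
    FV-binder : ∀ {p} → p ∈ binders ℓ → Disjoint (FVℓ ℓ) (positives (vars p))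
    FV-binder p∈ (x∈FV , x∈p) = disj (binder⊆BVℓ ℓ p∈ (positives-⊆ _ x∈p) , x∈FV)
    outArrows-binder : ∀ {p} → p ∈ binders ℓ → Disjoint (arrows out ∖ FVℓ ℓ) (positives (vars p))
    outArrows-binder {p} _ (x∈A , x∈p) =
      arrow⇒¬positive (proj₂ (∈-arrows⁻ out (proj₁ (∈-∖⁻ _ (FVℓ ℓ) x∈A))))
                      (proj₂ (∈-positives⁻ (vars p) x∈p))

lemma4 : (ty : ℕ → VTy) (ℓ : LetTerm) →
    let open WithTy ty in
    (∃[ U ] (ℓ ∶ℓ U)) →
    Unique (BVℓ ℓ) →
    Disjoint (BVℓ ℓ) (FVℓ ℓ) →
    PairwiseDisjoint (map vars (binders ℓ)) →
    (VarΓ (Facts ℓ) ≋ concat (FVℓ ℓ ∷ (arrows (vars (output ℓ)) ∖ FVℓ ℓ) ∷ map (λ p → positives (vars p)) (binders ℓ)))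
    × PairwiseDisjoint (FVℓ ℓ ∷ (arrows (vars (output ℓ)) ∖ FVℓ ℓ) ∷ map (λ p → positives (vars p)) (binders ℓ))
lemma4 ty ℓ (_ , tℓ) u disj pd =
  ( ⊆-trans (VarΓ-Facts-⊆ ty tℓ) (proj₁ (factVars-≋-varBlocks ty ℓ))
  , ⊆-trans (proj₂ (factVars-≋-varBlocks ty ℓ)) (factVars-⊆-VarΓ-Facts ty ℓ u disj) )
  , varBlocks-disjoint ty ℓ disj pd
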